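{- Let $d\ge 1$ and $m$ be positive integers and let $C=[0,m]^d\subset\mathbb{R}^d$. Then \[ f'_d(m)\le \frac{(m+1)^d-1}{2^d-1}. \] Moreover, equality holds when $m=2^k-1$ for some positive integer $k$.
   Context: A brick of $C$ is a set $[a_1,b_1]\times\cdots\times[a_d,b_d]$ with $a_i,b_i\in\mathbb{Z}$ and $0\le a_i<b_i\le m$. A system of brick islands in $C$ is a set $H$ of bricks of $C$ such that any two members are either nested (one contains the other) or disjoint. A system of cubic islands in $C$ is a system of brick islands in $C$ all of whose members are cubes. Let $I_C$ denote the set of systems of cubic islands in $C$ and $Max(I_C)$ its maximal elements with respect to inclusion. Define $f'_d(m)=\max\{|H|:H\in Max(I_C)\}$. -}

module Defs where

open import Relation.Binary.PropositionalEquality using (_≡_)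
open import Data.Nat using (ℕ; _<_; _≤_; _∸_)
open import Data.Fin using (Fin)
open import Data.Vec using (Vec; lookup)
open import Data.Product using (_×_; proj₁; proj₂; ∃; ∃-syntax)
open import Data.Sum using (_⊎_)
open import Data.List using (List)
open import Data.List.Membership.Propositional using (_∈_)
open import Data.List.Relation.Unary.Unique.Propositional using (Unique)
open import Data.List.Relation.Unary.All using (All)

Box : ℕ → Set
Box d = Vec (ℕ × ℕ) d

lo hi : ∀ {d} → Box d → Fin d → ℕ
lo B i = proj₁ (lookup B i)
hi B i = proj₂ (lookup B i)

IsBrick : ∀ {d} → ℕ → Box d → Set
IsBrick m B = ∀ i → (lo B i < hi B i) × (hi B i ≤ m)

IsCube : ∀ {d} → Box d → Set
IsCube B = ∃[ s ] (∀ i → hi B i ∸ lo B i ≡ s)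

-- Containment of (nonempty, closed) bricks as subsets of ℝ^d:
-- B ⊆ B' iff every coordinate interval of B lies in that of B'.
_⊆ᴮ_ : ∀ {d} → Box d → Box d → Set
B ⊆ᴮ B' = ∀ i → (lo B' i ≤ lo B i) × (hi B i ≤ hi B' i)

-- Disjointness of closed bricks as subsets of ℝ^d: their intersection is
-- empty iff in some coordinate the closed intervals are disjoint.
Disjoint : ∀ {d} → Box d → Box d → Set
Disjoint B B' = ∃[ i ] ((hi B i < lo B' i) ⊎ (hi B' i < lo B i))

-- A system of cubic islands in C = [0,m]^d: a finite set (duplicate-free
-- list) of cubes of C any two of which are nested or disjoint.
IsCubicSystem : (d m : ℕ) → List (Box d) → Set
IsCubicSystem d m H =
  Unique H ×
  All (λ B → IsBrick m B × IsCube B) H ×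
  (∀ {B B'} → B ∈ H → B' ∈ H → (B ⊆ᴮ B') ⊎ (B' ⊆ᴮ B) ⊎ Disjoint B B')

IsMaximalCubicSystem : (d m : ℕ) → List (Box d) → Set
IsMaximalCubicSystem d m H =
  IsCubicSystem d m H ×
  (∀ H' → IsCubicSystem d m H' → (∀ {B} → B ∈ H → B ∈ H') → (∀ {B} → B ∈ H' → B ∈ H))

module Submission where

open import Defs
open import Data.Nat using (ℕ; _≤_; _+_; _*_; _∸_; _^_)
open import Data.List using (List; length)
open import Data.Product using (_×_; ∃-syntax)
open import Relation.Binary.PropositionalEquality using (_≡_)

open import Data.Nat using (zero; suc; _<_; z≤n; s≤s; _≤?_)
open import Data.Nat.Properties
open import Data.Bool using (Bool; true; false; if_then_else_)
import Data.Bool.Properties as Bool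
open import Data.Fin using (Fin; zero; suc)
open import Data.Fin.Properties using (all?; ¬∀⟶∃¬)
open import Data.Vec using (Vec; []; _∷_; lookup; tabulate; replicate; zipWith)
open import Data.Vec.Properties using (tabulate∘lookup; tabulate-cong; lookup∘tabulate; ∷-injective; lookup-zipWith; lookup-replicate)
import Data.Vec.Properties as Vec
open import Data.List using ([]; _∷_; map; _++_; concat; cartesianProductWith; cartesianProduct; upTo; filter)
open import Data.List.Properties using (length-map; length-++; length-++-sucʳ; length-upTo)
open import Data.List.Membership.Propositional using (_∈_; _∉_)
open import Data.List.Membership.Propositional.Properties
open import Data.List.Relation.Unary.Any using (here; there)
open import Data.List.Relation.Unary.All as All using (All; []; _∷_)
import Data.List.Relation.Unary.All.Properties as All
open import Data.List.Relation.Unary.Unique.Propositional using (Unique)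
open import Data.List.Relation.Unary.AllPairs as AllPairs using ([]; _∷_)
import Data.List.Relation.Unary.AllPairs.Properties as AllPairs
import Data.List.Relation.Binary.Disjoint.Propositional as List
import Data.List.Relation.Unary.Unique.Propositional.Properties as Unique
open import Data.List.Extrema.Nat using (argmax; argmax-sel; f[⊥]≤f[argmax]; f[xs]≤f[argmax])
open import Data.Product using (_,_; proj₁; proj₂)
import Data.Product.Properties as Product
open import Data.Sum using (_⊎_; inj₁; inj₂)
open import Data.Sum.Properties using (inj₁-injective; inj₂-injective)
open import Data.Empty using (⊥-elim)
open import Relation.Nullary using (¬_; Dec; yes; no; ¬?)
open import Relation.Nullary.Decidable using (_×-dec_; map′; isYes)
open import Relation.Binary.PropositionalEquality using (_≢_; refl; sym; trans; cong; cong₂; subst; subst₂; module ≡-Reasoning)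
open import Data.Nat.Tactic.RingSolver using (solve-∀)

-- Upper bound (for any system, maximal or not).  Label each pair (Q , b) of an island Q and a
-- corner b ∈ {0,1}^d of Q by the largest island strictly inside Q containing that corner, or, if
-- there is none, by the corner point itself.  Since islands sharing a point are nested and a
-- sub-cube containing two corners of a cube is the cube, the labelling is injective; its values
-- are lattice points of C or islands, and an island of maximal size is never a label.  Hence
-- 2^d |H| + 1 ≤ (m+1)^d + |H|, which rearranges to the bound.
--
-- For m = 2^k - 1 take the dyadic system: C together with, recursively, the dyadic
-- systems of the 2^d cubes of side 2^(k-1) - 1 at the corners of C.  It has
-- ((2^k)^d - 1)/(2^d - 1) members, and it is maximal since a compatible cube lies in a child
-- (induction), equals a child, or is all of C.

-- Finite lists: counting duplicate-free lists and enumerating vectors.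

∈-delete : ∀ {A : Set} {x z : A} (ys zs : List A) → z ∈ ys ++ x ∷ zs → z ≢ x → z ∈ ys ++ zs
∈-delete ys zs z∈ z≢x with ∈-++⁻ ys z∈
... | inj₁ z∈ys = ∈-++⁺ˡ z∈ys
... | inj₂ (here z≡x) = ⊥-elim (z≢x z≡x)
... | inj₂ (there z∈zs) = ∈-++⁺ʳ ys z∈zs

unique-⊆-length : ∀ {A : Set} (xs ys : List A) → Unique xs → (∀ {z} → z ∈ xs → z ∈ ys) →
  length xs ≤ length ys
unique-⊆-length [] ys _ _ = z≤n
unique-⊆-length (x ∷ xs) ys (x∉xs ∷ xs!) xs⊆ys with ∈-∃++ (xs⊆ys (here refl))
... | ys₁ , ys₂ , refl = subst (suc (length xs) ≤_) (sym (length-++-sucʳ ys₁ x ys₂))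
      (s≤s (unique-⊆-length xs (ys₁ ++ ys₂) xs! xs⊆rest))
  where
  xs⊆rest : ∀ {z} → z ∈ xs → z ∈ ys₁ ++ ys₂
  xs⊆rest z∈ = ∈-delete ys₁ ys₂ (xs⊆ys (there z∈)) (λ z≡x → All.lookup x∉xs z∈ (sym z≡x))

map-unique : ∀ {A B : Set} (f : A → B) {xs : List A} → Unique xs →
  (∀ {x y} → x ∈ xs → y ∈ xs → f x ≡ f y → x ≡ y) → Unique (map f xs)
map-unique f [] _ = []
map-unique f (x∉xs ∷ xs!) f-inj =
  All.map⁺ (All.tabulate (λ y∈ fx≡fy → All.lookup x∉xs y∈ (f-inj (here refl) (there y∈) fx≡fy)))
  ∷ map-unique f xs! (λ x∈ y∈ → f-inj (there x∈) (there y∈))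

argmax-∈ : ∀ {A : Set} (f : A → ℕ) x xs → argmax f x xs ∈ x ∷ xs
argmax-∈ f x xs with argmax-sel f x xs
... | inj₁ ≡x = here ≡x
... | inj₂ ∈xs = there ∈xs

argmax-maximal : ∀ {A : Set} (f : A → ℕ) x xs {y} → y ∈ x ∷ xs → f y ≤ f (argmax f x xs)
argmax-maximal f x xs (here refl) = f[⊥]≤f[argmax] {f = f} x xs
argmax-maximal f x xs (there y∈xs) = All.lookup (f[xs]≤f[argmax] {f = f} x xs) y∈xs

length-cartesianProductWith : ∀ {A B C : Set} (f : A → B → C) (xs : List A) (ys : List B) →
  length (cartesianProductWith f xs ys) ≡ length xs * length ys
length-cartesianProductWith f [] ys = refl
length-cartesianProductWith f (x ∷ xs) ys = trans (length-++ (map (f x) ys))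
  (cong₂ _+_ (length-map (f x) ys) (length-cartesianProductWith f xs ys))

length-concat-map : ∀ {A B : Set} (f : A → List B) {N} → (∀ x → length (f x) ≡ N) → ∀ xs →
  length (concat (map f xs)) ≡ length xs * N
length-concat-map f f-length [] = refl
length-concat-map f f-length (x ∷ xs) =
  trans (length-++ (f x)) (cong₂ _+_ (f-length x) (length-concat-map f f-length xs))

vectorsOver : ∀ {A : Set} → List A → (d : ℕ) → List (Vec A d)
vectorsOver xs zero = [] ∷ []
vectorsOver xs (suc d) = cartesianProductWith _∷_ xs (vectorsOver xs d)

length-vectorsOver : ∀ {A : Set} (xs : List A) d → length (vectorsOver xs d) ≡ length xs ^ d
length-vectorsOver xs zero = refl
length-vectorsOver xs (suc d) = trans (length-cartesianProductWith _∷_ xs (vectorsOver xs d))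
  (cong (length xs *_) (length-vectorsOver xs d))

∈-vectorsOver : ∀ {A : Set} (xs : List A) {d} (v : Vec A d) → (∀ i → lookup v i ∈ xs) →
  v ∈ vectorsOver xs d
∈-vectorsOver xs [] _ = here refl
∈-vectorsOver xs (x ∷ v) v⊆xs =
  ∈-cartesianProductWith⁺ _∷_ (v⊆xs zero) (∈-vectorsOver xs v (λ i → v⊆xs (suc i)))

unique-vectorsOver : ∀ {A : Set} {xs : List A} d → Unique xs → Unique (vectorsOver xs d)
unique-vectorsOver zero xs! = [] ∷ []
unique-vectorsOver (suc d) xs! = Unique.cartesianProductWith⁺ _∷_ ∷-injective xs! (unique-vectorsOver d xs!)

-- The 2^d sign patterns, used to name the corners of a box.
patterns : (d : ℕ) → List (Vec Bool d)
patterns = vectorsOver (true ∷ false ∷ [])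

length-patterns : ∀ d → length (patterns d) ≡ 2 ^ d
length-patterns = length-vectorsOver (true ∷ false ∷ [])

∈-patterns : ∀ {d} (b : Vec Bool d) → b ∈ patterns d
∈-patterns b = ∈-vectorsOver _ b (λ i → bool∈ (lookup b i))
  where
  bool∈ : ∀ c → c ∈ true ∷ false ∷ []
  bool∈ true = here refl
  bool∈ false = there (here refl)

unique-patterns : ∀ d → Unique (patterns d)
unique-patterns d = unique-vectorsOver d (((λ ()) ∷ []) ∷ [] ∷ [])

gridPoints : ℕ → (d : ℕ) → List (Vec ℕ d)
gridPoints m = vectorsOver (upTo (suc m))

length-gridPoints : ∀ m d → length (gridPoints m d) ≡ suc m ^ d
length-gridPoints m d = trans (length-vectorsOver (upTo (suc m)) d) (cong (_^ d) (length-upTo (suc m)))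

∈-gridPoints : ∀ m {d} (p : Vec ℕ d) → (∀ i → lookup p i ≤ m) → p ∈ gridPoints m d
∈-gridPoints m p p≤m = ∈-vectorsOver (upTo (suc m)) p (λ i → ∈-upTo⁺ (s≤s (p≤m i)))

-- Geometry of bricks: lattice points, nesting, cubes and their corners.

private
  variable
    d : ℕ

vec-ext : ∀ {A : Set} {n} (u v : Vec A n) → (∀ i → lookup u i ≡ lookup v i) → u ≡ v
vec-ext u v u≗v = trans (sym (tabulate∘lookup u)) (trans (tabulate-cong u≗v) (tabulate∘lookup v))

differ-somewhere : (b b' : Vec Bool d) → b ≢ b' → ∃[ i ] lookup b i ≢ lookup b' i
differ-somewhere {d} b b' b≢b' =
  ¬∀⟶∃¬ d (λ i → lookup b i ≡ lookup b' i) (λ i → lookup b i Bool.≟ lookup b' i)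
    (λ b≗b' → b≢b' (vec-ext b b' b≗b'))

-- Lattice points of a brick (a record, so that p and B can be inferred).
record _∈ᵖ_ (p : Vec ℕ d) (B : Box d) : Set where
  constructor inside
  field within : ∀ i → lo B i ≤ lookup p i × lookup p i ≤ hi B i
open _∈ᵖ_

Wellformed : Box d → Set
Wellformed B = ∀ i → lo B i ≤ hi B i

_HasSide_ : Box d → ℕ → Set
B HasSide s = ∀ i → hi B i ∸ lo B i ≡ s

⊆ᴮ-refl : {B : Box d} → B ⊆ᴮ B
⊆ᴮ-refl i = ≤-refl , ≤-refl

⊆ᴮ-trans : {A B C : Box d} → A ⊆ᴮ B → B ⊆ᴮ C → A ⊆ᴮ C
⊆ᴮ-trans A⊆B B⊆C i = ≤-trans (proj₁ (B⊆C i)) (proj₁ (A⊆B i)) , ≤-trans (proj₂ (A⊆B i)) (proj₂ (B⊆C i))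

⊆ᴮ-antisym : {A B : Box d} → A ⊆ᴮ B → B ⊆ᴮ A → A ≡ B
⊆ᴮ-antisym {A = A} {B} A⊆B B⊆A = vec-ext A B (λ i →
  cong₂ _,_ (≤-antisym (proj₁ (B⊆A i)) (proj₁ (A⊆B i))) (≤-antisym (proj₂ (A⊆B i)) (proj₂ (B⊆A i))))

∈ᵖ-⊆ᴮ : ∀ {p} {A B : Box d} → p ∈ᵖ A → A ⊆ᴮ B → p ∈ᵖ B
∈ᵖ-⊆ᴮ (inside p∈A) A⊆B = inside (λ i →
  ≤-trans (proj₁ (A⊆B i)) (proj₁ (p∈A i)) , ≤-trans (proj₂ (p∈A i)) (proj₂ (A⊆B i)))

common-point : ∀ {p} {A B : Box d} → p ∈ᵖ A → p ∈ᵖ B → ¬ Disjoint A B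
common-point (inside p∈A) (inside p∈B) (i , inj₁ hiA<loB) = <⇒≱ hiA<loB (≤-trans (proj₁ (p∈B i)) (proj₂ (p∈A i)))
common-point (inside p∈A) (inside p∈B) (i , inj₂ hiB<loA) = <⇒≱ hiB<loA (≤-trans (proj₁ (p∈A i)) (proj₂ (p∈B i)))

Disjoint-⊆ᴮ : {A A' B B' : Box d} → A ⊆ᴮ A' → B ⊆ᴮ B' → Disjoint A' B' → Disjoint A B
Disjoint-⊆ᴮ A⊆A' B⊆B' (i , inj₁ lt) = i , inj₁ (≤-<-trans (proj₂ (A⊆A' i)) (<-≤-trans lt (proj₁ (B⊆B' i))))
Disjoint-⊆ᴮ A⊆A' B⊆B' (i , inj₂ lt) = i , inj₂ (≤-<-trans (proj₂ (B⊆B' i)) (<-≤-trans lt (proj₁ (A⊆A' i))))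

interval-eq : ∀ {a b c e} → a ≤ b → b ≤ c → c ≤ e → e ∸ a ≤ c ∸ b → a ≡ b × c ≡ e
interval-eq {a} {b} {c} {e} a≤b b≤c c≤e long =
  ∸-cancelˡ-≡ (≤-trans a≤b b≤e) b≤e ea≡eb , ∸-cancelʳ-≡ b≤c b≤e cb≡eb
  where
  b≤e : b ≤ e
  b≤e = ≤-trans b≤c c≤e
  eb≤ea : e ∸ b ≤ e ∸ a
  eb≤ea = ∸-monoʳ-≤ e a≤b
  cb≤eb : c ∸ b ≤ e ∸ b
  cb≤eb = ∸-monoˡ-≤ b c≤e
  ea≡eb : e ∸ a ≡ e ∸ b
  ea≡eb = ≤-antisym (≤-trans long cb≤eb) eb≤ea
  cb≡eb : c ∸ b ≡ e ∸ b
  cb≡eb = ≤-antisym cb≤eb (≤-trans eb≤ea long)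

cube-⊆-eq : ∀ {A B : Box d} {s t} → A ⊆ᴮ B → Wellformed A → A HasSide s → B HasSide t → t ≤ s → A ≡ B
cube-⊆-eq {A = A} {B} A⊆B A-wf sideA sideB t≤s = vec-ext A B (λ i →
  let lo≡ , hi≡ = interval-eq (proj₁ (A⊆B i)) (A-wf i) (proj₂ (A⊆B i))
                    (subst₂ _≤_ (sym (sideB i)) (sym (sideA i)) t≤s)
  in cong₂ _,_ (sym lo≡) hi≡)

-- The corner of B selected by a sign pattern b (true = upper end).
corner : Box d → Vec Bool d → Vec ℕ d
corner B b = tabulate (λ i → if lookup b i then hi B i else lo B i)

lookup-corner : ∀ (B : Box d) b i → lookup (corner B b) i ≡ (if lookup b i then hi B i else lo B i)
lookup-corner B b i = lookup∘tabulate (λ i → if lookup b i then hi B i else lo B i) i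

corner-∈ : ∀ (B : Box d) b → Wellformed B → corner B b ∈ᵖ B
corner-∈ B b B-wf = inside λ i →
  subst (λ v → lo B i ≤ v × v ≤ hi B i) (sym (lookup-corner B b i)) (end i (lookup b i))
  where
  end : ∀ i c → lo B i ≤ (if c then hi B i else lo B i) × (if c then hi B i else lo B i) ≤ hi B i
  end i true = B-wf i , ≤-refl
  end i false = ≤-refl , B-wf i

⊆-both-disjoint : {B A A' : Box d} → Wellformed B → B ⊆ᴮ A → B ⊆ᴮ A' → ¬ Disjoint A A'
⊆-both-disjoint {d} {B} {A} {A'} B-wf B⊆A B⊆A' =
  common-point {A = A} {A'} (∈ᵖ-⊆ᴮ c∈B B⊆A) (∈ᵖ-⊆ᴮ c∈B B⊆A')
  where
  c∈B : corner B (replicate d false) ∈ᵖ B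
  c∈B = corner-∈ B (replicate d false) B-wf

end-injective : ∀ {l h} c c' → l < h → (if c then h else l) ≡ (if c' then h else l) → c ≡ c'
end-injective true true _ _ = refl
end-injective false false _ _ = refl
end-injective true false l<h h≡l = ⊥-elim (<⇒≢ l<h (sym h≡l))
end-injective false true l<h l≡h = ⊥-elim (<⇒≢ l<h l≡h)

corner-injective : ∀ (B : Box d) {b b'} → (∀ i → lo B i < hi B i) → corner B b ≡ corner B b' → b ≡ b'
corner-injective B {b} {b'} lo<hi same = vec-ext b b' (λ i →
  end-injective (lookup b i) (lookup b' i) (lo<hi i)
    (trans (sym (lookup-corner B b i)) (trans (cong (λ v → lookup v i) same) (lookup-corner B b' i))))

both-ends : ∀ {l h a e} c c' → c ≢ c' →
  a ≤ (if c then h else l) × (if c then h else l) ≤ e →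
  a ≤ (if c' then h else l) × (if c' then h else l) ≤ e → a ≤ l × h ≤ e
both-ends true true c≢c' _ _ = ⊥-elim (c≢c' refl)
both-ends false false c≢c' _ _ = ⊥-elim (c≢c' refl)
both-ends true false _ (_ , h≤e) (a≤l , _) = a≤l , h≤e
both-ends false true _ (a≤l , _) (_ , h≤e) = a≤l , h≤e

two-corners⇒≡ : ∀ {K Q : Box d} {s t b b'} → K ⊆ᴮ Q → Wellformed K → K HasSide s → Q HasSide t →
  corner Q b ∈ᵖ K → corner Q b' ∈ᵖ K → b ≢ b' → K ≡ Q
two-corners⇒≡ {K = K} {Q} {b = b} {b'} K⊆Q K-wf sideK sideQ cb∈K cb'∈K b≢b'
  with differ-somewhere b b' b≢b'
... | i , bi≢b'i = cube-⊆-eq K⊆Q K-wf sideK sideQ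
  (subst₂ _≤_ (sideQ i) (sideK i) (∸-mono (proj₂ spans) (proj₁ spans)))
  where
  spans : lo K i ≤ lo Q i × hi Q i ≤ hi K i
  spans = both-ends (lookup b i) (lookup b' i) bi≢b'i
    (subst (λ v → lo K i ≤ v × v ≤ hi K i) (lookup-corner Q b i) (within cb∈K i))
    (subst (λ v → lo K i ≤ v × v ≤ hi K i) (lookup-corner Q b' i) (within cb'∈K i))

_⊆ᴮ?_ : (A B : Box d) → Dec (A ⊆ᴮ B)
A ⊆ᴮ? B = all? (λ i → (lo B i ≤? lo A i) ×-dec (hi A i ≤? hi B i))

_∈ᵖ?_ : (p : Vec ℕ d) (B : Box d) → Dec (p ∈ᵖ B)
p ∈ᵖ? B = map′ inside within (all? (λ i → (lo B i ≤? lookup p i) ×-dec (lookup p i ≤? hi B i)))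

_≟ᴮ_ : (A B : Box d) → Dec (A ≡ B)
_≟ᴮ_ = Vec.≡-dec (Product.≡-dec _≟_ _≟_)

count-arith : ∀ L P q → 1 ≤ q → suc (L * q) ≤ P + L → L * (q ∸ 1) ≤ P ∸ 1
count-arith L P (suc q) _ bound = suc≤⇒≤∸1 (+-cancelˡ-≤ L (suc (L * q)) P
  (subst₂ _≤_ (trans (cong suc (*-suc L q)) (sym (+-suc L (L * q)))) (+-comm P L) bound))
  where
  suc≤⇒≤∸1 : ∀ {x n} → suc x ≤ n → x ≤ n ∸ 1
  suc≤⇒≤∸1 (s≤s x≤n) = x≤n

-- Fix a system H of cubic islands in [0,m]^d and a coordinate i₀ used to measure sizes.
module UpperBound {d m : ℕ} (i₀ : Fin d) {H : List (Box d)} (sys : IsCubicSystem d m H) where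

  brick : ∀ {B} → B ∈ H → IsBrick m B
  brick B∈H = proj₁ (All.lookup (proj₁ (proj₂ sys)) B∈H)

  wellformed : ∀ {B} → B ∈ H → Wellformed B
  wellformed B∈H i = <⇒≤ (proj₁ (brick B∈H i))

  side : ∀ {B} → B ∈ H → ℕ
  side B∈H = proj₁ (proj₂ (All.lookup (proj₁ (proj₂ sys)) B∈H))

  hasSide : ∀ {B} (B∈H : B ∈ H) → B HasSide side B∈H
  hasSide B∈H = proj₂ (proj₂ (All.lookup (proj₁ (proj₂ sys)) B∈H))

  nested : ∀ {A B p} → A ∈ H → B ∈ H → p ∈ᵖ A → p ∈ᵖ B → A ⊆ᴮ B ⊎ B ⊆ᴮ A
  nested {A} {B} {p} A∈H B∈H p∈A p∈B with proj₂ (proj₂ sys) A∈H B∈H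
  ... | inj₁ A⊆B = inj₁ A⊆B
  ... | inj₂ (inj₁ B⊆A) = inj₂ B⊆A
  ... | inj₂ (inj₂ A∩B=∅) = ⊥-elim (common-point {p = p} {A} {B} p∈A p∈B A∩B=∅)

  size : Box d → ℕ
  size B = hi B i₀ ∸ lo B i₀

  ⊆-size-eq : ∀ {A B} → A ∈ H → B ∈ H → A ⊆ᴮ B → size B ≤ size A → A ≡ B
  ⊆-size-eq A∈H B∈H A⊆B size≤ = cube-⊆-eq A⊆B (wellformed A∈H) (hasSide A∈H) (hasSide B∈H)
    (subst₂ _≤_ (hasSide B∈H i₀) (hasSide A∈H i₀) size≤)

  record Below (Q : Box d) (b : Vec Bool d) (K : Box d) : Set where
    constructor below
    field
      inner : K ⊆ᴮ Q
      proper : K ≢ Q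
      has-corner : corner Q b ∈ᵖ K

  below? : ∀ Q b K → Dec (Below Q b K)
  below? Q b K = map′ (λ (K⊆Q , K≢Q , c∈K) → below K⊆Q K≢Q c∈K) (λ (below K⊆Q K≢Q c∈K) → K⊆Q , K≢Q , c∈K)
    ((K ⊆ᴮ? Q) ×-dec (¬? (K ≟ᴮ Q) ×-dec (corner Q b ∈ᵖ? K)))

  labelFrom : Vec ℕ d → List (Box d) → Vec ℕ d ⊎ Box d
  labelFrom c [] = inj₁ c
  labelFrom c (K ∷ Ks) = inj₂ (argmax size K Ks)

  label : Box d × Vec Bool d → Vec ℕ d ⊎ Box d
  label (Q , b) = labelFrom (corner Q b) (filter (below? Q b) H)

  data LabelView (Q : Box d) (b : Vec Bool d) : Set where
    point : label (Q , b) ≡ inj₁ (corner Q b) →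
      (∀ {K} → K ∈ H → K ⊆ᴮ Q → corner Q b ∈ᵖ K → K ≡ Q) → LabelView Q b
    island : ∀ K → label (Q , b) ≡ inj₂ K → K ∈ H → Below Q b K →
      (∀ {K'} → K' ∈ H → Below Q b K' → K' ⊆ᴮ K) → LabelView Q b

  labelView : ∀ Q b → LabelView Q b
  labelView Q b with filter (below? Q b) H in below≡
  ... | [] = point (cong (labelFrom (corner Q b)) below≡) noneBelow
    where
    noneBelow : ∀ {K} → K ∈ H → K ⊆ᴮ Q → corner Q b ∈ᵖ K → K ≡ Q
    noneBelow {K} K∈H K⊆Q c∈K with K ≟ᴮ Q
    ... | yes K≡Q = K≡Q
    ... | no K≢Q with () ← subst (K ∈_) below≡ (∈-filter⁺ (below? Q b) K∈H (below K⊆Q K≢Q c∈K))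
  ... | K ∷ Ks = island L (cong (labelFrom (corner Q b)) below≡) (proj₁ (candidate L∈)) (proj₂ (candidate L∈)) largest
    where
    L : Box d
    L = argmax size K Ks
    L∈ : L ∈ K ∷ Ks
    L∈ = argmax-∈ size K Ks
    candidate : ∀ {K'} → K' ∈ K ∷ Ks → K' ∈ H × Below Q b K'
    candidate K'∈ = ∈-filter⁻ (below? Q b) (subst (_ ∈_) (sym below≡) K'∈)
    -- All islands below the corner contain it, so they form a chain; the largest tops it.
    largest : ∀ {K'} → K' ∈ H → Below Q b K' → K' ⊆ᴮ L
    largest {K'} K'∈H K'-below
      with nested K'∈H (proj₁ (candidate L∈)) (Below.has-corner K'-below) (Below.has-corner (proj₂ (candidate L∈)))
    ... | inj₁ K'⊆L = K'⊆L
    ... | inj₂ L⊆K' = subst (K' ⊆ᴮ_) (sym (⊆-size-eq (proj₁ (candidate L∈)) K'∈H L⊆K'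
            (argmax-maximal size K Ks (subst (_ ∈_) below≡ (∈-filter⁺ (below? Q b) K'∈H K'-below)))))
            (⊆ᴮ-refl {B = K'})

  point-label-injective : ∀ {Q Q' b b'} → Q ∈ H → Q' ∈ H → corner Q b ≡ corner Q' b' →
    (∀ {K} → K ∈ H → K ⊆ᴮ Q → corner Q b ∈ᵖ K → K ≡ Q) →
    (∀ {K} → K ∈ H → K ⊆ᴮ Q' → corner Q' b' ∈ᵖ K → K ≡ Q') → (Q , b) ≡ (Q' , b')
  point-label-injective {Q} {Q'} {b} {b'} Q∈H Q'∈H same noneQ noneQ' =
    cong₂ _,_ Q≡Q' (corner-injective Q' (λ i → proj₁ (brick Q'∈H i))
                     (subst (λ X → corner X b ≡ corner Q' b') Q≡Q' same))
    where
    c∈Q : corner Q b ∈ᵖ Q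
    c∈Q = corner-∈ Q b (wellformed Q∈H)
    c∈Q' : corner Q b ∈ᵖ Q'
    c∈Q' = subst (_∈ᵖ Q') (sym same) (corner-∈ Q' b' (wellformed Q'∈H))
    Q≡Q' : Q ≡ Q'
    Q≡Q' with nested {Q} {Q'} Q∈H Q'∈H c∈Q c∈Q'
    ... | inj₁ Q⊆Q' = noneQ' Q∈H Q⊆Q' (subst (_∈ᵖ Q) same c∈Q)
    ... | inj₂ Q'⊆Q = sym (noneQ Q'∈H Q'⊆Q c∈Q')

  largest-below-⊆ : ∀ {Q Q' b b' K} → Q ∈ H → Q ⊆ᴮ Q' → Below Q b K → Below Q' b' K →
    (∀ {K'} → K' ∈ H → Below Q' b' K' → K' ⊆ᴮ K) → Q ≡ Q'
  largest-below-⊆ {Q} {Q'} {K = K} Q∈H Q⊆Q' (below K⊆Q K≢Q _) (below _ _ c'∈K) largest with Q ≟ᴮ Q'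
  ... | yes Q≡Q' = Q≡Q'
  ... | no Q≢Q' = ⊥-elim (K≢Q (⊆ᴮ-antisym K⊆Q
        (largest Q∈H (below Q⊆Q' Q≢Q' (∈ᵖ-⊆ᴮ c'∈K K⊆Q)))))

  island-label-parent : ∀ {Q Q' b b' K} → Q ∈ H → Q' ∈ H → Below Q b K → Below Q' b' K →
    (∀ {K'} → K' ∈ H → Below Q b K' → K' ⊆ᴮ K) →
    (∀ {K'} → K' ∈ H → Below Q' b' K' → K' ⊆ᴮ K) → Q ≡ Q'
  island-label-parent {Q} {Q'} {b} {K = K} Q∈H Q'∈H K-below K-below' largest largest'
    with nested Q∈H Q'∈H (∈ᵖ-⊆ᴮ (Below.has-corner K-below) (Below.inner K-below))
                         (∈ᵖ-⊆ᴮ (Below.has-corner K-below) (Below.inner K-below'))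
  ... | inj₁ Q⊆Q' = largest-below-⊆ Q∈H Q⊆Q' K-below K-below' largest'
  ... | inj₂ Q'⊆Q = sym (largest-below-⊆ Q'∈H Q'⊆Q K-below' K-below largest)

  island-label-corner : ∀ {Q b b' K} → Q ∈ H → K ∈ H → Below Q b K → Below Q b' K → b ≡ b'
  island-label-corner {b = b} {b'} Q∈H K∈H (below K⊆Q K≢Q cb∈K) (below _ _ cb'∈K) with Vec.≡-dec Bool._≟_ b b'
  ... | yes b≡b' = b≡b'
  ... | no b≢b' = ⊥-elim (K≢Q (two-corners⇒≡ K⊆Q (wellformed K∈H) (hasSide K∈H) (hasSide Q∈H)
                                 cb∈K cb'∈K b≢b'))

  label-injective : ∀ {Q Q' b b'} → Q ∈ H → Q' ∈ H → label (Q , b) ≡ label (Q' , b') →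
    (Q , b) ≡ (Q' , b')
  label-injective {Q} {Q'} {b} {b'} Q∈H Q'∈H same with labelView Q b | labelView Q' b'
  ... | point ℓ none | point ℓ' none' =
    point-label-injective Q∈H Q'∈H (inj₁-injective (trans (sym ℓ) (trans same ℓ'))) none none'
  ... | point ℓ _ | island _ ℓ' _ _ _ with () ← trans (sym ℓ) (trans same ℓ')
  ... | island _ ℓ _ _ _ | point ℓ' _ with () ← trans (sym ℓ) (trans same ℓ')
  ... | island K ℓ K∈H K-below largest | island K' ℓ' _ K-below' largest'
    with inj₂-injective (trans (sym ℓ) (trans same ℓ'))
  ... | refl with island-label-parent Q∈H Q'∈H K-below K-below' largest largest'
  ... | refl = cong (Q ,_) (island-label-corner Q∈H K∈H K-below K-below')

  corners : List (Box d × Vec Bool d)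
  corners = cartesianProduct H (patterns d)

  labels : List (Vec ℕ d ⊎ Box d)
  labels = map label corners

  unique-labels : Unique labels
  unique-labels = map-unique label (Unique.cartesianProduct⁺ (proj₁ sys) (unique-patterns d))
    (λ Qb∈ Qb'∈ → label-injective (proj₁ (∈-cartesianProduct⁻ H (patterns d) Qb∈))
                                   (proj₁ (∈-cartesianProduct⁻ H (patterns d) Qb'∈)))

  length-labels : length labels ≡ length H * 2 ^ d
  length-labels = trans (length-map label corners)
    (trans (length-cartesianProductWith _,_ H (patterns d)) (cong (length H *_) (length-patterns d)))

  targets : List (Vec ℕ d ⊎ Box d)
  targets = map inj₁ (gridPoints m d) ++ map inj₂ H

  length-targets : length targets ≡ suc m ^ d + length H
  length-targets = trans (length-++ (map inj₁ (gridPoints m d)))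
    (cong₂ _+_ (trans (length-map inj₁ (gridPoints m d)) (length-gridPoints m d)) (length-map inj₂ H))

  label-target : ∀ {z} → z ∈ labels → z ∈ targets
  label-target z∈ with ∈-map⁻ label z∈
  ... | (Q , b) , Qb∈ , refl with labelView Q b
  ... | point ℓ _ = subst (_∈ targets) (sym ℓ) (∈-++⁺ˡ (∈-map⁺ inj₁ (∈-gridPoints m (corner Q b) in-C)))
    where
    Q∈H : Q ∈ H
    Q∈H = proj₁ (∈-cartesianProduct⁻ H (patterns d) Qb∈)
    in-C : ∀ i → lookup (corner Q b) i ≤ m
    in-C i = ≤-trans (proj₂ (within (corner-∈ Q b (wellformed Q∈H)) i)) (proj₂ (brick Q∈H i))
  ... | island K ℓ K∈H _ _ = subst (_∈ targets) (sym ℓ) (∈-++⁺ʳ _ (∈-map⁺ inj₂ K∈H))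

  -- An island of maximal size lies below no corner, so it is not a label.
  largest-unlabelled : ∀ {R} → (∀ {B} → B ∈ H → size B ≤ size R) → inj₂ R ∉ labels
  largest-unlabelled R-max R∈ with ∈-map⁻ label R∈
  ... | (Q , b) , Qb∈ , R≡ℓ with labelView Q b
  ... | point ℓ _ with () ← trans R≡ℓ ℓ
  ... | island K ℓ K∈H (below K⊆Q K≢Q _) _ with inj₂-injective (trans R≡ℓ ℓ)
  ... | refl = K≢Q (⊆-size-eq K∈H Q∈H K⊆Q (R-max Q∈H))
    where
    Q∈H : Q ∈ H
    Q∈H = proj₁ (∈-cartesianProduct⁻ H (patterns d) Qb∈)

  -- The labels, together with the largest island R, are distinct targets.
  counting : ∀ {R} → R ∈ H → (∀ {B} → B ∈ H → size B ≤ size R) →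
    suc (length H * 2 ^ d) ≤ suc m ^ d + length H
  counting R∈H R-max = subst₂ _≤_ (cong suc length-labels) length-targets
    (unique-⊆-length (inj₂ _ ∷ labels) targets
      (All.¬Any⇒All¬ labels (largest-unlabelled R-max) ∷ unique-labels)
      λ { (here refl) → ∈-++⁺ʳ (map inj₁ (gridPoints m d)) (∈-map⁺ inj₂ R∈H)
        ; (there z∈) → label-target z∈ })

cubic-system-bound : ∀ d m (H : List (Box d)) → IsCubicSystem d m H →
  length H * (2 ^ d ∸ 1) ≤ (m + 1) ^ d ∸ 1
cubic-system-bound zero m H _ = subst (_≤ (m + 1) ^ 0 ∸ 1) (sym (*-zeroʳ (length H))) z≤n
cubic-system-bound (suc n) m [] _ = z≤n
cubic-system-bound (suc n) m (B ∷ Bs) sys =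
  subst (λ k → length (B ∷ Bs) * (2 ^ suc n ∸ 1) ≤ k ^ suc n ∸ 1) (+-comm 1 m)
    (count-arith (length (B ∷ Bs)) (suc m ^ suc n) (2 ^ suc n) (m^n>0 2 (suc n))
      (counting (argmax-∈ size B Bs) (argmax-maximal size B Bs)))
  where
  open UpperBound zero sys

-- span j = 2^j - 1 is the side of a level-j dyadic cube.
span : ℕ → ℕ
span zero = 0
span (suc j) = 2 ^ j + span j

span+1 : ∀ j → span j + 1 ≡ 2 ^ j
span+1 zero = refl
span+1 (suc j) = trans (+-assoc (2 ^ j) (span j) 1)
  (cong (2 ^ j +_) (trans (span+1 j) (sym (+-identityʳ (2 ^ j)))))

span≡ : ∀ j → span j ≡ 2 ^ j ∸ 1
span≡ j = trans (sym (m+n∸n≡m (span j) 1)) (cong (_∸ 1) (span+1 j))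

span<2^ : ∀ j → span j < 2 ^ j
span<2^ j = subst (span j <_) (span+1 j) (≤-reflexive (+-comm 1 (span j)))

-- In one coordinate, [a, a + span (J+1)] is the union of its lower half [a, a + span J]
-- and its upper half [a + 2^J, a + 2^J + span J], separated by a gap.
half : ℕ → ℕ → Bool → ℕ
half J a c = if c then a + 2 ^ J else a

half-⊆ : ∀ J a c → a ≤ half J a c × half J a c + span J ≤ a + span (suc J)
half-⊆ J a true = m≤m+n a (2 ^ J) , ≤-reflexive (+-assoc a (2 ^ J) (span J))
half-⊆ J a false = ≤-refl , +-monoʳ-≤ a (m≤n+m (span J) (2 ^ J))

halves-disjoint : ∀ J a c c' → c ≢ c' →
  half J a c + span J < half J a c' ⊎ half J a c' + span J < half J a c
halves-disjoint J a true true c≢c' = ⊥-elim (c≢c' refl)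
halves-disjoint J a false false c≢c' = ⊥-elim (c≢c' refl)
halves-disjoint J a true false _ = inj₂ (+-monoʳ-< a (span<2^ J))
halves-disjoint J a false true _ = inj₁ (+-monoʳ-< a (span<2^ J))

half-∈ : ∀ J a p → a ≤ p → p ≤ a + span (suc J) →
  half J a (isYes (a + 2 ^ J ≤? p)) ≤ p × p ≤ half J a (isYes (a + 2 ^ J ≤? p)) + span J
half-∈ J a p a≤p p≤end with a + 2 ^ J ≤? p
... | yes a+2^J≤p = a+2^J≤p , subst (p ≤_) (sym (+-assoc a (2 ^ J) (span J))) p≤end
... | no a+2^J≰p = a≤p , ≤-pred (subst (suc p ≤_) gap (≰⇒> a+2^J≰p))
  where
  gap : a + 2 ^ J ≡ suc (a + span J)
  gap = trans (cong (a +_) (trans (sym (span+1 J)) (+-comm (span J) 1))) (+-suc a (span J))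

-- Dyadic systems in dimension d ≥ 1; the coordinate i₀ is used to compare sides of cubes.
module Dyadic {d : ℕ} (i₀ : Fin d) where

  cube : Vec ℕ d → ℕ → Box d
  cube y s = tabulate (λ i → lookup y i , lookup y i + s)

  lo-cube : ∀ y s i → lo (cube y s) i ≡ lookup y i
  lo-cube y s i = cong proj₁ (lookup∘tabulate (λ i → lookup y i , lookup y i + s) i)

  hi-cube : ∀ y s i → hi (cube y s) i ≡ lookup y i + s
  hi-cube y s i = cong proj₂ (lookup∘tabulate (λ i → lookup y i , lookup y i + s) i)

  cube-∈ : ∀ {p} y s → (∀ i → lookup y i ≤ lookup p i × lookup p i ≤ lookup y i + s) → p ∈ᵖ cube y s
  cube-∈ {p} y s bounds = inside (λ i → subst₂ (λ l u → l ≤ lookup p i × lookup p i ≤ u)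
    (sym (lo-cube y s i)) (sym (hi-cube y s i)) (bounds i))

  cube-∈⁻ : ∀ {p} y s → p ∈ᵖ cube y s → ∀ i → lookup y i ≤ lookup p i × lookup p i ≤ lookup y i + s
  cube-∈⁻ {p} y s p∈ i = subst₂ (λ l u → l ≤ lookup p i × lookup p i ≤ u)
    (lo-cube y s i) (hi-cube y s i) (within p∈ i)

  cube-⊆ : ∀ y s z u → (∀ i → lookup z i ≤ lookup y i × lookup y i + s ≤ lookup z i + u) →
    cube y s ⊆ᴮ cube z u
  cube-⊆ y s z u bounds i
    rewrite lo-cube y s i | hi-cube y s i | lo-cube z u i | hi-cube z u i = bounds i

  cube-disjoint : ∀ y s z u i → lookup y i + s < lookup z i ⊎ lookup z i + u < lookup y i →
    Disjoint (cube y s) (cube z u)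
  cube-disjoint y s z u i gap = i , separated
    where
    separated : hi (cube y s) i < lo (cube z u) i ⊎ hi (cube z u) i < lo (cube y s) i
    separated rewrite lo-cube y s i | hi-cube y s i | lo-cube z u i | hi-cube z u i = gap

  cube-wellformed : ∀ y s → Wellformed (cube y s)
  cube-wellformed y s i = subst₂ _≤_ (sym (lo-cube y s i)) (sym (hi-cube y s i)) (m≤m+n (lookup y i) s)

  cube-proper : ∀ y {s} → 1 ≤ s → ∀ i → lo (cube y s) i < hi (cube y s) i
  cube-proper y {s} 1≤s i = subst₂ _<_ (sym (lo-cube y s i)) (sym (hi-cube y s i)) (m<m+n (lookup y i) 1≤s)

  cube-hasSide : ∀ y s → cube y s HasSide s
  cube-hasSide y s i = trans (cong₂ _∸_ (hi-cube y s i) (lo-cube y s i)) (m+n∸m≡n (lookup y i) s)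

  cube-⊆-side : ∀ {y s z u} → cube y s ⊆ᴮ cube z u → s ≤ u
  cube-⊆-side {y} {s} {z} {u} y⊆z = subst₂ _≤_ (cube-hasSide y s i₀) (cube-hasSide z u i₀)
    (∸-mono (proj₂ (y⊆z i₀)) (proj₁ (y⊆z i₀)))

  -- The children of the level-(J+1) cube at x: the 2^d level-J cubes at its corners.
  shift : ℕ → Vec ℕ d → Vec Bool d → Vec ℕ d
  shift J x b = zipWith (half J) x b

  lookup-shift : ∀ J x b i → lookup (shift J x b) i ≡ half J (lookup x i) (lookup b i)
  lookup-shift J x b i = lookup-zipWith (half J) i x b

  child : ℕ → Vec ℕ d → Vec Bool d → Box d
  child J x b = cube (shift J x b) (span J)

  child-⊆ : ∀ J x b → child J x b ⊆ᴮ cube x (span (suc J))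
  child-⊆ J x b = cube-⊆ (shift J x b) (span J) x (span (suc J)) (λ i → subst (λ v → lookup x i ≤ v × v + span J ≤ lookup x i + span (suc J))
    (sym (lookup-shift J x b i)) (half-⊆ J (lookup x i) (lookup b i)))

  children-disjoint : ∀ J x {b b'} → b ≢ b' → Disjoint (child J x b) (child J x b')
  children-disjoint J x {b} {b'} b≢b' with differ-somewhere b b' b≢b'
  ... | i , bi≢b'i = cube-disjoint (shift J x b) (span J) (shift J x b') (span J) i separated
    where
    separated : lookup (shift J x b) i + span J < lookup (shift J x b') i ⊎
                lookup (shift J x b') i + span J < lookup (shift J x b) i
    separated rewrite lookup-shift J x b i | lookup-shift J x b' i =
      halves-disjoint J (lookup x i) (lookup b i) (lookup b' i) bi≢b'i

  which-child : ℕ → Vec ℕ d → Vec ℕ d → Vec Bool d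
  which-child J x p = tabulate (λ i → isYes (lookup x i + 2 ^ J ≤? lookup p i))

  lookup-which-child : ∀ J x p i → lookup (shift J x (which-child J x p)) i ≡
    half J (lookup x i) (isYes (lookup x i + 2 ^ J ≤? lookup p i))
  lookup-which-child J x p i = trans (lookup-shift J x (which-child J x p) i)
    (cong (half J (lookup x i)) (lookup∘tabulate (λ i → isYes (lookup x i + 2 ^ J ≤? lookup p i)) i))

  child-∋ : ∀ J x {p} → p ∈ᵖ cube x (span (suc J)) → p ∈ᵖ child J x (which-child J x p)
  child-∋ J x {p} p∈ = cube-∈ (shift J x (which-child J x p)) (span J) (λ i →
    subst (λ v → v ≤ lookup p i × lookup p i ≤ v + span J) (sym (lookup-which-child J x p i))
      (half-∈ J (lookup x i) (lookup p i) (proj₁ (cube-∈⁻ x _ p∈ i)) (proj₂ (cube-∈⁻ x _ p∈ i))))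

  dyadic : ℕ → Vec ℕ d → List (Box d)
  dyadic zero x = []
  dyadic (suc J) x = cube x (span (suc J)) ∷ concat (map (λ b → dyadic J (shift J x b)) (patterns d))

  descendants : ℕ → Vec ℕ d → List (Box d)
  descendants J x = concat (map (λ b → dyadic J (shift J x b)) (patterns d))

  ∈-descendants⁻ : ∀ J x {B} → B ∈ descendants J x → ∃[ b ] B ∈ dyadic J (shift J x b)
  ∈-descendants⁻ J x B∈ with ∈-concat⁻′ (map (λ b → dyadic J (shift J x b)) (patterns d)) B∈
  ... | _ , B∈L , L∈ with ∈-map⁻ (λ b → dyadic J (shift J x b)) L∈
  ... | b , _ , refl = b , B∈L

  ∈-descendants⁺ : ∀ J x b {B} → B ∈ dyadic J (shift J x b) → B ∈ descendants J x
  ∈-descendants⁺ J x b B∈ = ∈-concat⁺′ B∈ (∈-map⁺ (λ b → dyadic J (shift J x b)) (∈-patterns b))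

  dyadic-⊆ : ∀ j x {B} → B ∈ dyadic j x → B ⊆ᴮ cube x (span j)
  dyadic-⊆ (suc J) x (here refl) = ⊆ᴮ-refl {B = cube x (span (suc J))}
  dyadic-⊆ (suc J) x {B} (there B∈) with ∈-descendants⁻ J x B∈
  ... | b , B∈child = ⊆ᴮ-trans {A = B} {child J x b} {cube x (span (suc J))} (dyadic-⊆ J (shift J x b) B∈child) (child-⊆ J x b)

  dyadic-cube : ∀ j x {B} → B ∈ dyadic j x → ∃[ y ] ∃[ s ] (1 ≤ s × B ≡ cube y s)
  dyadic-cube (suc J) x (here refl) = x , span (suc J) , ≤-trans (m^n>0 2 J) (m≤m+n (2 ^ J) (span J)) , refl
  dyadic-cube (suc J) x (there B∈) with ∈-descendants⁻ J x B∈
  ... | b , B∈child = dyadic-cube J (shift J x b) B∈child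

  dyadic-wellformed : ∀ j x {B} → B ∈ dyadic j x → Wellformed B
  dyadic-wellformed j x B∈ with dyadic-cube j x B∈
  ... | y , s , _ , refl = cube-wellformed y s

  -- The top cube is not a descendant: descendants have smaller side.
  top∉descendants : ∀ J x → cube x (span (suc J)) ∉ descendants J x
  top∉descendants J x top∈ with ∈-descendants⁻ J x top∈
  ... | b , top∈child = <⇒≱ (m<n+m (span J) (m^n>0 2 J))
    (cube-⊆-side {x} {span (suc J)} {shift J x b} {span J} (dyadic-⊆ J (shift J x b) top∈child))

  dyadic-unique : ∀ j x → Unique (dyadic j x)
  dyadic-unique zero x = []
  dyadic-unique (suc J) x = All.¬Any⇒All¬ _ (top∉descendants J x)
    ∷ Unique.concat⁺ (All.map⁺ (All.tabulate (λ {b} _ → dyadic-unique J (shift J x b))))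
                     (AllPairs.map⁺ (AllPairs.map no-common-member (unique-patterns d)))
    where
    -- Systems of distinct children lie in disjoint cubes.
    no-common-member : ∀ {b b'} → b ≢ b' → List.Disjoint (dyadic J (shift J x b)) (dyadic J (shift J x b'))
    no-common-member {b} {b'} b≢b' {B} (B∈ , B∈') = ⊆-both-disjoint {B = B} {child J x b} {child J x b'}
      (dyadic-wellformed J _ B∈)
      (dyadic-⊆ J _ B∈) (dyadic-⊆ J _ B∈') (children-disjoint J x b≢b')

  dyadic-laminar : ∀ j x {B B'} → B ∈ dyadic j x → B' ∈ dyadic j x → B ⊆ᴮ B' ⊎ B' ⊆ᴮ B ⊎ Disjoint B B'
  dyadic-laminar (suc J) x (here refl) (here refl) = inj₁ (⊆ᴮ-refl {B = cube x (span (suc J))})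
  dyadic-laminar (suc J) x (here refl) (there B'∈) = inj₂ (inj₁ (dyadic-⊆ (suc J) x (there B'∈)))
  dyadic-laminar (suc J) x (there B∈) (here refl) = inj₁ (dyadic-⊆ (suc J) x (there B∈))
  dyadic-laminar (suc J) x {B} {B'} (there B∈) (there B'∈)
    with ∈-descendants⁻ J x B∈ | ∈-descendants⁻ J x B'∈
  ... | b , B∈child | b' , B'∈child with Vec.≡-dec Bool._≟_ b b'
  ... | yes refl = dyadic-laminar J (shift J x b) B∈child B'∈child
  ... | no b≢b' = inj₂ (inj₂ (Disjoint-⊆ᴮ {A = B} {child J x b} {B'} {child J x b'} (dyadic-⊆ J _ B∈child) (dyadic-⊆ J _ B'∈child)
                                          (children-disjoint J x b≢b')))

  dyadic-count : ℕ → ℕ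
  dyadic-count zero = 0
  dyadic-count (suc J) = 1 + 2 ^ d * dyadic-count J

  length-dyadic : ∀ j x → length (dyadic j x) ≡ dyadic-count j
  length-dyadic zero x = refl
  length-dyadic (suc J) x = cong suc (trans
    (length-concat-map (λ b → dyadic J (shift J x b)) (λ b → length-dyadic J (shift J x b)) (patterns d))
    (cong (_* dyadic-count J) (length-patterns d)))

  dyadic-count-closed : ∀ j → dyadic-count j * (2 ^ d ∸ 1) + 1 ≡ (2 ^ j) ^ d
  dyadic-count-closed zero = sym (^-zeroˡ d)
  dyadic-count-closed (suc J) = begin
    (1 + 2 ^ d * N) * q + 1   ≡⟨ cong (λ z → (1 + z * N) * q + 1) (sym q+1) ⟩
    (1 + (q + 1) * N) * q + 1 ≡⟨ regroup q N ⟩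
    (q + 1) * (N * q + 1)     ≡⟨ cong₂ _*_ q+1 (dyadic-count-closed J) ⟩
    2 ^ d * (2 ^ J) ^ d       ≡⟨ cong (2 ^ d *_) (^-*-assoc 2 J d) ⟩
    2 ^ d * 2 ^ (J * d)       ≡⟨ sym (^-distribˡ-+-* 2 d (J * d)) ⟩
    2 ^ (suc J * d)           ≡⟨ sym (^-*-assoc 2 (suc J) d) ⟩
    (2 ^ suc J) ^ d           ∎
    where
    open ≡-Reasoning
    N q : ℕ
    N = dyadic-count J
    q = 2 ^ d ∸ 1
    q+1 : q + 1 ≡ 2 ^ d
    q+1 = m∸n+n≡m (m^n>0 2 d)
    regroup : ∀ q N → (1 + (q + 1) * N) * q + 1 ≡ (q + 1) * (N * q + 1)
    regroup = solve-∀

  Compatible : Box d → List (Box d) → Set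
  Compatible B L = ∀ {K} → K ∈ L → B ⊆ᴮ K ⊎ K ⊆ᴮ B ⊎ Disjoint B K

  -- A cube B of side s inside the level-(J+1) cube D at x, compared with the children K₀ and K₁
  -- containing its lowest and its highest corner.
  module Inside (J : ℕ) (x : Vec ℕ d) {B : Box d} {s : ℕ}
                (B-wf : Wellformed B) (B-side : B HasSide s) (B⊆D : B ⊆ᴮ cube x (span (suc J))) where

    low high : Vec ℕ d
    low = tabulate (lo B)
    high = tabulate (hi B)

    low∈B : low ∈ᵖ B
    low∈B = inside (λ i → subst (λ v → lo B i ≤ v × v ≤ hi B i) (sym (lookup∘tabulate (lo B) i)) (≤-refl , B-wf i))

    high∈B : high ∈ᵖ B
    high∈B = inside (λ i → subst (λ v → lo B i ≤ v × v ≤ hi B i) (sym (lookup∘tabulate (hi B) i)) (B-wf i , ≤-refl))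

    b₀ b₁ : Vec Bool d
    b₀ = which-child J x low
    b₁ = which-child J x high

    low∈K₀ : low ∈ᵖ child J x b₀
    low∈K₀ = child-∋ J x (∈ᵖ-⊆ᴮ low∈B B⊆D)

    high∈K₁ : high ∈ᵖ child J x b₁
    high∈K₁ = child-∋ J x (∈ᵖ-⊆ᴮ high∈B B⊆D)

    x₀ : ℕ
    x₀ = lookup x i₀

    hi≡lo+s : hi B i₀ ≡ lo B i₀ + s
    hi≡lo+s = trans (sym (m+[n∸m]≡n (B-wf i₀))) (cong (lo B i₀ +_) (B-side i₀))

    x≤lo : x₀ ≤ lo B i₀
    x≤lo = subst (_≤ lo B i₀) (lo-cube x _ i₀) (proj₁ (B⊆D i₀))

    hi≤end : hi B i₀ ≤ x₀ + 2 ^ J + span J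
    hi≤end = subst (hi B i₀ ≤_) (trans (hi-cube x _ i₀) (sym (+-assoc x₀ (2 ^ J) (span J)))) (proj₂ (B⊆D i₀))

    starts : child J x b₀ ⊆ᴮ B → 2 ^ J ≤ s → lo B i₀ ≤ x₀
    starts K₀⊆B 2^J≤s with x₀ + 2 ^ J ≤? lookup low i₀ | lookup-which-child J x low i₀
    ... | no _ | K₀-start = subst (lo B i₀ ≤_) (trans (lo-cube (shift J x b₀) (span J) i₀) K₀-start) (proj₁ (K₀⊆B i₀))
    ... | yes x+2^J≤low | _ = ⊥-elim (<⇒≱ (+-monoʳ-< (x₀ + 2 ^ J) (span<2^ J))
          (≤-trans (+-mono-≤ (subst (x₀ + 2 ^ J ≤_) (lookup∘tabulate (lo B) i₀) x+2^J≤low) 2^J≤s)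
                   (subst (_≤ x₀ + 2 ^ J + span J) hi≡lo+s hi≤end)))

    ends : child J x b₁ ⊆ᴮ B → 2 ^ J ≤ s → x₀ + 2 ^ J + span J ≤ hi B i₀
    ends K₁⊆B 2^J≤s with x₀ + 2 ^ J ≤? lookup high i₀ | lookup-which-child J x high i₀
    ... | yes _ | K₁-start = subst (_≤ hi B i₀) (trans (hi-cube (shift J x b₁) (span J) i₀) (cong (_+ span J) K₁-start))
                              (proj₂ (K₁⊆B i₀))
    ... | no x+2^J≰high | _ = ⊥-elim (x+2^J≰high (subst (x₀ + 2 ^ J ≤_)
          (trans (sym hi≡lo+s) (sym (lookup∘tabulate (hi B) i₀))) (+-mono-≤ x≤lo 2^J≤s)))

    whole : child J x b₀ ⊆ᴮ B → child J x b₁ ⊆ᴮ B → 2 ^ J ≤ s → B ≡ cube x (span (suc J))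
    whole K₀⊆B K₁⊆B 2^J≤s = cube-⊆-eq B⊆D B-wf B-side (cube-hasSide x (span (suc J)))
      (subst₂ _≤_ D-side (B-side i₀) (∸-mono (ends K₁⊆B 2^J≤s) (starts K₀⊆B 2^J≤s)))
      where
      D-side : x₀ + 2 ^ J + span J ∸ x₀ ≡ span (suc J)
      D-side = trans (cong (_∸ x₀) (+-assoc x₀ (2 ^ J) (span J))) (m+n∸m≡n x₀ (span (suc J)))

  dyadic-complete : ∀ J x {B s} → (∀ i → lo B i < hi B i) → B HasSide s →
    B ⊆ᴮ cube x (span (suc J)) → Compatible B (dyadic (suc J) x) → B ∈ dyadic (suc J) x
  dyadic-complete zero x {B} {s} B-proper B-side B⊆D _ =
    here (cube-⊆-eq B⊆D (λ i → <⇒≤ (B-proper i)) B-side (cube-hasSide x 1)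
      (subst (1 ≤_) (B-side i₀) (m<n⇒0<n∸m (B-proper i₀))))
  dyadic-complete (suc J) x {B} {s} B-proper B-side B⊆D compatible =
    by-cases (compatible K₀∈) (compatible K₁∈)
    where
    open Inside (suc J) x {B} (λ i → <⇒≤ (B-proper i)) B-side B⊆D
    K₀ K₁ : Box d
    K₀ = child (suc J) x b₀
    K₁ = child (suc J) x b₁
    K₀∈ : K₀ ∈ dyadic (suc (suc J)) x
    K₀∈ = there (∈-descendants⁺ (suc J) x b₀ (here refl))
    K₁∈ : K₁ ∈ dyadic (suc (suc J)) x
    K₁∈ = there (∈-descendants⁺ (suc J) x b₁ (here refl))
    in-child : ∀ b → B ⊆ᴮ child (suc J) x b → B ∈ dyadic (suc (suc J)) x
    in-child b B⊆K = there (∈-descendants⁺ (suc J) x b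
      (dyadic-complete J (shift (suc J) x b) B-proper B-side B⊆K
        (λ K∈ → compatible (there (∈-descendants⁺ (suc J) x b K∈)))))
    -- Otherwise B contains both K₀ and K₁, so it is K₀ (if small) or the whole cube (if large).
    by-cases : B ⊆ᴮ K₀ ⊎ K₀ ⊆ᴮ B ⊎ Disjoint B K₀ → B ⊆ᴮ K₁ ⊎ K₁ ⊆ᴮ B ⊎ Disjoint B K₁ →
      B ∈ dyadic (suc (suc J)) x
    by-cases (inj₁ B⊆K₀) _ = in-child b₀ B⊆K₀
    by-cases (inj₂ (inj₂ B∩K₀=∅)) _ = ⊥-elim (common-point low∈B low∈K₀ B∩K₀=∅)
    by-cases (inj₂ (inj₁ _)) (inj₁ B⊆K₁) = in-child b₁ B⊆K₁
    by-cases (inj₂ (inj₁ _)) (inj₂ (inj₂ B∩K₁=∅)) = ⊥-elim (common-point high∈B high∈K₁ B∩K₁=∅)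
    by-cases (inj₂ (inj₁ K₀⊆B)) (inj₂ (inj₁ K₁⊆B)) with s ≤? span (suc J)
    ... | yes small = subst (_∈ dyadic (suc (suc J)) x)
          (cube-⊆-eq {A = K₀} {B} K₀⊆B (cube-wellformed (shift (suc J) x b₀) (span (suc J)))
            (cube-hasSide (shift (suc J) x b₀) (span (suc J))) B-side small) K₀∈
    ... | no large = here (whole K₀⊆B K₁⊆B
          (subst (_≤ s) (trans (+-comm 1 (span (suc J))) (span+1 (suc J))) (≰⇒> large)))

  origin : Vec ℕ d
  origin = replicate d 0

  lo-C : ∀ k i → lo (cube origin (span k)) i ≡ 0
  lo-C k i = trans (lo-cube origin (span k) i) (lookup-replicate i 0)

  hi-C : ∀ k i → hi (cube origin (span k)) i ≡ span k
  hi-C k i = trans (hi-cube origin (span k) i) (cong (_+ span k) (lookup-replicate i 0))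

  dyadic-system : ∀ k → IsCubicSystem d (span k) (dyadic k origin)
  dyadic-system k = dyadic-unique k origin , All.tabulate cubic-brick , dyadic-laminar k origin
    where
    cubic-brick : ∀ {B} → B ∈ dyadic k origin → IsBrick (span k) B × IsCube B
    cubic-brick B∈ with dyadic-cube k origin B∈ | dyadic-⊆ k origin B∈
    ... | y , s , 1≤s , refl | B⊆C =
      (λ i → cube-proper y 1≤s i , subst (hi (cube y s) i ≤_) (hi-C k i) (proj₂ (B⊆C i))) ,
      s , cube-hasSide y s

  dyadic-maximal : ∀ J → IsMaximalCubicSystem d (span (suc J)) (dyadic (suc J) origin)
  dyadic-maximal J = dyadic-system (suc J) , extension-included
    where
    extension-included : ∀ H' → IsCubicSystem d (span (suc J)) H' →
      (∀ {B} → B ∈ dyadic (suc J) origin → B ∈ H') → ∀ {B} → B ∈ H' → B ∈ dyadic (suc J) origin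
    extension-included H' (_ , cubes , laminar) dyadic⊆H' {B} B∈H' with All.lookup cubes B∈H'
    ... | brick , s , B-side =
      dyadic-complete J origin (λ i → proj₁ (brick i)) B-side B⊆C (λ K∈ → laminar B∈H' (dyadic⊆H' K∈))
      where
      B⊆C : B ⊆ᴮ cube origin (span (suc J))
      B⊆C i = subst (_≤ lo B i) (sym (lo-C (suc J) i)) z≤n , subst (hi B i ≤_) (sym (hi-C (suc J) i)) (proj₂ (brick i))

  dyadic-attains : ∀ J → ∃[ H ] (IsMaximalCubicSystem d (span (suc J)) H ×
    length H * (2 ^ d ∸ 1) ≡ (span (suc J) + 1) ^ d ∸ 1)
  dyadic-attains J = dyadic (suc J) origin , dyadic-maximal J , (begin
    length (dyadic (suc J) origin) * q  ≡⟨ cong (_* q) (length-dyadic (suc J) origin) ⟩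
    dyadic-count (suc J) * q            ≡⟨ sym (m+n∸n≡m (dyadic-count (suc J) * q) 1) ⟩
    dyadic-count (suc J) * q + 1 ∸ 1    ≡⟨ cong (_∸ 1) (dyadic-count-closed (suc J)) ⟩
    (2 ^ suc J) ^ d ∸ 1                 ≡⟨ cong (λ n → n ^ d ∸ 1) (sym (span+1 (suc J))) ⟩
    (span (suc J) + 1) ^ d ∸ 1          ∎)
    where
    open ≡-Reasoning
    q : ℕ
    q = 2 ^ d ∸ 1

theorem3 : (d m : ℕ) → 1 ≤ d → 1 ≤ m →
    (∀ (H : List (Box d)) → IsMaximalCubicSystem d m H →
       length H * (2 ^ d ∸ 1) ≤ (m + 1) ^ d ∸ 1)
    × (∀ (k : ℕ) → 1 ≤ k → m ≡ 2 ^ k ∸ 1 →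
       ∃[ H ] (IsMaximalCubicSystem d m H × length H * (2 ^ d ∸ 1) ≡ (m + 1) ^ d ∸ 1))
theorem3 (suc n) m _ _ = (λ H maximal → cubic-system-bound (suc n) m H (proj₁ maximal)) , attained
  where
  attained : ∀ k → 1 ≤ k → m ≡ 2 ^ k ∸ 1 →
    ∃[ H ] (IsMaximalCubicSystem (suc n) m H × length H * (2 ^ suc n ∸ 1) ≡ (m + 1) ^ suc n ∸ 1)
  attained (suc J) _ m≡ = subst
    (λ m → ∃[ H ] (IsMaximalCubicSystem (suc n) m H × length H * (2 ^ suc n ∸ 1) ≡ (m + 1) ^ suc n ∸ 1))
    (trans (span≡ (suc J)) (sym m≡)) (Dyadic.dyadic-attains zero J)
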